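{- For the algorithmic structural equality of IITT: (1) If $\Delta\vdash n \longleftrightarrow_{\mathsf{ne}} n_1 : A_1$ and $\Delta\vdash n \longleftrightarrow_{\mathsf{ne}} n_2 : A_2$, then $A_1\equiv A_2$. (2) If $\Delta\vdash n \Longleftrightarrow_{\mathsf{ne}} n_1 : T_1$ and $\Delta\vdash n \Longleftrightarrow_{\mathsf{ne}} n_2 : T_2$, then $T_1\equiv T_2$. Here $\equiv$ is syntactic identity up to $\alpha$-equivalence.
   Context: Syntax of IITT: sorts $\mathsf{Set}_k$ ($k\in\mathbb{N}$); annotations $\star\in\{:,\div\}$; expressions $t,u,T,U ::= s \mid (x\star U)\to^{s,s'}T \mid x \mid \lambda x\star U.\,t \mid t\star u$ (relevant/irrelevant function types annotated with domain and codomain sorts, abstractions, relevant application $t\,u$ and irrelevant application $t\div u$), modulo $\alpha$-equivalence; $[u/x]t$ is substitution. Contexts $\Delta ::= ()\mid \Delta.x\star T$. Weak head normal forms: $a,A ::= s\mid (x\star U)\to^{s,s'}T\mid \lambda x\star U.t\mid n$; neutrals $n,N ::= x\mid n\star u$. Weak head evaluation $t\searrow a$ and active application $f\,@^\star u\searrow a$: $a\searrow a$ for a whnf $a$; if $t\searrow f$ and $f\,@^\star u\searrow a$ then $t\star u\searrow a$; if $[u/x]t\searrow a$ then $(\lambda x\star U.t)\,@^\star u\searrow a$; $n\,@^\star u\searrow n\star u$ for neutral $n$. Algorithmic equality consists of the following mutually inductive judgements (long arrows act on whnf types, double arrows on arbitrary types). Type equality: $\Delta\vdash T\Longleftrightarrow_{\mathsf{ty}}T'$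 if $T\searrow A$, $T'\searrow A'$, $\Delta\vdash A\longleftrightarrow_{\mathsf{ty}}A'$; $\Delta\vdash s\longleftrightarrow_{\mathsf{ty}}s$; $\Delta\vdash (x\star U)\to^{s,s'}T\longleftrightarrow_{\mathsf{ty}}(x\star U')\to^{s,s'}T'$ if $\Delta\vdash U\Longleftrightarrow_{\mathsf{ty}}U'$ and $\Delta.x\star U\vdash T\Longleftrightarrow_{\mathsf{ty}}T'$; $\Delta\vdash N\longleftrightarrow_{\mathsf{ty}}N'$ for neutrals if $\Delta\vdash N\Longleftrightarrow_{\mathsf{ne}}N':T$ for some $T$. Structural equality (the type is an output): $\Delta\vdash x\Longleftrightarrow_{\mathsf{ne}}x:T$ if $(x:T)\in\Delta$; $\Delta\vdash n\,u\Longleftrightarrow_{\mathsf{ne}}n'\,u':[u/x]T$ if $\Delta\vdash n\longleftrightarrow_{\mathsf{ne}}n':(x:U)\to^{s,s'}T$ and $\Delta\vdash u\Longleftrightarrow_{\mathsf{tm}}u':U$; $\Delta\vdash n\div u\Longleftrightarrow_{\mathsf{ne}}n'\div u':[u/x]T$ if $\Delta\vdash n\longleftrightarrow_{\mathsf{ne}}n':(x\div U)\to^{s,s'}T$; $\Delta\vdash n\longleftrightarrow_{\mathsf{ne}}n':A$ if $\Delta\vdash n\Longleftrightarrow_{\mathsf{ne}}n':T$ and $T\searrow A$. Type-directed equality: $\Delta\vdash t\Longleftrightarrow_{\mathsf{tm}}t':T$ if $T\searrow A$ and $\Delta\vdash t\longleftrightarrow_{\mathsf{tm}}t':A$; $\Delta\vdash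 t\longleftrightarrow_{\mathsf{tm}}t':(x\star U)\to^{s,s'}T$ if $\Delta.x\star U\vdash t\star x\Longleftrightarrow_{\mathsf{tm}}t'\star x:T$; $\Delta\vdash T\longleftrightarrow_{\mathsf{tm}}T':s$ if $\Delta\vdash T\Longleftrightarrow_{\mathsf{ty}}T'$; $\Delta\vdash t\longleftrightarrow_{\mathsf{tm}}t':N$ for neutral $N$ if $t\searrow n$, $t'\searrow n'$ and $\Delta\vdash n\Longleftrightarrow_{\mathsf{ne}}n':T$ for some $T$. -}

module Defs where

open import Data.Nat using (ℕ; zero; suc)
open import Data.List using (List; []; _∷_)
open import Data.Product using (_×_; _,_; ∃)

data Ann : Set where
  rel irr : Ann

Sort : Set
Sort = ℕ

-- Expressions, with de Bruijn indices (so α-equivalence is syntactic equality).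
-- pi a U s s' T  is  (x ⋆ U) →^{s,s'} T  with T under one binder.
-- lam a U t      is  λ x ⋆ U. t          with t under one binder.
-- app a t u      is  t ⋆ u.
data Tm : Set where
  sort : Sort → Tm
  pi   : Ann → Tm → Sort → Sort → Tm → Tm
  var  : ℕ → Tm
  lam  : Ann → Tm → Tm → Tm
  app  : Ann → Tm → Tm → Tm

Ren : Set
Ren = ℕ → ℕ

liftR : Ren → Ren
liftR ρ zero    = zero
liftR ρ (suc i) = suc (ρ i)

ren : Ren → Tm → Tm
ren ρ (sort s)        = sort s
ren ρ (pi a U s s' T) = pi a (ren ρ U) s s' (ren (liftR ρ) T)
ren ρ (var i)         = var (ρ i)
ren ρ (lam a U t)     = lam a (ren ρ U) (ren (liftR ρ) t)
ren ρ (app a t u)     = app a (ren ρ t) (ren ρ u)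

wk : Tm → Tm
wk = ren suc

Sub : Set
Sub = ℕ → Tm

liftS : Sub → Sub
liftS σ zero    = var zero
liftS σ (suc i) = wk (σ i)

sub : Sub → Tm → Tm
sub σ (sort s)        = sort s
sub σ (pi a U s s' T) = pi a (sub σ U) s s' (sub (liftS σ) T)
sub σ (var i)         = σ i
sub σ (lam a U t)     = lam a (sub σ U) (sub (liftS σ) t)
sub σ (app a t u)     = app a (sub σ t) (sub σ u)

single : Tm → Sub
single u zero    = u
single u (suc i) = var i

-- [u/x]t where x is the outermost bound variable (index 0) of t
_[_] : Tm → Tm → Tm
t [ u ] = sub (single u) t

data Ne : Tm → Set where
  ne-var : ∀ i → Ne (var i)
  ne-app : ∀ a n u → Ne n → Ne (app a n u)

data Whnf : Tm → Set where
  wh-sort : ∀ s → Whnf (sort s)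
  wh-pi   : ∀ a U s s' T → Whnf (pi a U s s' T)
  wh-lam  : ∀ a U t → Whnf (lam a U t)
  wh-ne   : ∀ n → Ne n → Whnf n

-- Weak head evaluation  t ↘ a  and active application  f @^a u ↘ b
mutual
  data _↘_ : Tm → Tm → Set where
    ev-whnf : ∀ {a} → Whnf a → a ↘ a
    ev-app  : ∀ {ann t u f a} → t ↘ f → App f ann u a → app ann t u ↘ a

  data App : Tm → Ann → Tm → Tm → Set where
    ap-beta : ∀ {ann U t u a} → (t [ u ]) ↘ a → App (lam ann U t) ann u a
    ap-ne   : ∀ {ann n u} → Ne n → App n ann u (app ann n u)

-- Contexts: the head of the list is the most recently bound variable (index 0).
Ctx : Set
Ctx = List (Ann × Tm)

-- (var i ⋆ T) ∈ Δ, with T weakened to live in Δ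
data _∋_⦂_⦂_ : Ctx → ℕ → Ann → Tm → Set where
  here  : ∀ {Δ a T} → ((a , T) ∷ Δ) ∋ zero ⦂ a ⦂ wk T
  there : ∀ {Δ b i a T} → Δ ∋ i ⦂ a ⦂ T → (b ∷ Δ) ∋ suc i ⦂ a ⦂ wk T

mutual
  data _⊢_⟺ty_ : Ctx → Tm → Tm → Set where
    ty-ev : ∀ {Δ T T' A A'} → T ↘ A → T' ↘ A' → Δ ⊢ A ⟷ty A' → Δ ⊢ T ⟺ty T'

  data _⊢_⟷ty_ : Ctx → Tm → Tm → Set where
    ty-sort : ∀ {Δ s} → Δ ⊢ sort s ⟷ty sort s
    ty-pi   : ∀ {Δ a U U' s s' T T'} → Δ ⊢ U ⟺ty U' → ((a , U) ∷ Δ) ⊢ T ⟺ty T'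
            → Δ ⊢ pi a U s s' T ⟷ty pi a U' s s' T'
    ty-ne   : ∀ {Δ N N' T} → Ne N → Ne N' → Δ ⊢ N ⟺ne N' ⦂ T → Δ ⊢ N ⟷ty N'

  data _⊢_⟺ne_⦂_ : Ctx → Tm → Tm → Tm → Set where
    ne-var : ∀ {Δ i T} → Δ ∋ i ⦂ rel ⦂ T → Δ ⊢ var i ⟺ne var i ⦂ T
    ne-rel : ∀ {Δ n n' u u' U s s' T} → Δ ⊢ n ⟷ne n' ⦂ pi rel U s s' T → Δ ⊢ u ⟺tm u' ⦂ U
           → Δ ⊢ app rel n u ⟺ne app rel n' u' ⦂ (T [ u ])
    ne-irr : ∀ {Δ n n' u u' U s s' T} → Δ ⊢ n ⟷ne n' ⦂ pi irr U s s' T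
           → Δ ⊢ app irr n u ⟺ne app irr n' u' ⦂ (T [ u ])

  data _⊢_⟷ne_⦂_ : Ctx → Tm → Tm → Tm → Set where
    ne-ev : ∀ {Δ n n' T A} → Δ ⊢ n ⟺ne n' ⦂ T → T ↘ A → Δ ⊢ n ⟷ne n' ⦂ A

  data _⊢_⟺tm_⦂_ : Ctx → Tm → Tm → Tm → Set where
    tm-ev : ∀ {Δ t t' T A} → T ↘ A → Δ ⊢ t ⟷tm t' ⦂ A → Δ ⊢ t ⟺tm t' ⦂ T

  data _⊢_⟷tm_⦂_ : Ctx → Tm → Tm → Tm → Set where
    tm-pi   : ∀ {Δ t t' a U s s' T}
            → ((a , U) ∷ Δ) ⊢ app a (wk t) (var zero) ⟺tm app a (wk t') (var zero) ⦂ T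
            → Δ ⊢ t ⟷tm t' ⦂ pi a U s s' T
    tm-sort : ∀ {Δ T T' s} → Δ ⊢ T ⟺ty T' → Δ ⊢ T ⟷tm T' ⦂ sort s
    tm-ne   : ∀ {Δ t t' N n n' T} → Ne N → t ↘ n → t' ↘ n' → Ne n → Ne n'
            → Δ ⊢ n ⟺ne n' ⦂ T → Δ ⊢ t ⟷tm t' ⦂ N

module Submission where

-- Weak head evaluation is deterministic and a variable's type is determined
-- by the context, so by simultaneous induction on the two derivations the
-- inferred type of a neutral depends only on the neutral on the left: at an
-- application both derivations infer the same Π-type for the head, hence the
-- same codomain, which is instantiated with the same argument.

open import Defs
open import Data.Product using (_×_; _,_)
open import Relation.Binary.PropositionalEquality using (_≡_; refl; sym; cong)

mutual
  whnf-↘-self : ∀ {a b} → Whnf a → a ↘ b → a ≡ b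
  whnf-↘-self _ (ev-whnf _) = refl
  whnf-↘-self (wh-ne _ (ne-app _ _ _ n)) (ev-app n↘f stuck) with whnf-↘-self (wh-ne _ n) n↘f
  ... | refl = ne-App-stuck n stuck

  ne-App-stuck : ∀ {n ann u b} → Ne n → App n ann u b → app ann n u ≡ b
  ne-App-stuck () (ap-beta _)
  ne-App-stuck _ (ap-ne _) = refl

mutual
  ↘-deterministic : ∀ {t a b} → t ↘ a → t ↘ b → a ≡ b
  ↘-deterministic (ev-whnf w) t↘b = whnf-↘-self w t↘b
  ↘-deterministic t↘a (ev-whnf w) = sym (whnf-↘-self w t↘a)
  ↘-deterministic (ev-app t↘f app₁) (ev-app t↘f′ app₂) with ↘-deterministic t↘f t↘f′
  ... | refl = App-deterministic app₁ app₂

  App-deterministic : ∀ {f ann u a b} → App f ann u a → App f ann u b → a ≡ b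
  App-deterministic (ap-beta t↘a) (ap-beta t↘b) = ↘-deterministic t↘a t↘b
  App-deterministic (ap-beta _) (ap-ne ())
  App-deterministic (ap-ne ()) (ap-beta _)
  App-deterministic (ap-ne _) (ap-ne _) = refl

∋-type-unique : ∀ {Δ i a b T T′} → Δ ∋ i ⦂ a ⦂ T → Δ ∋ i ⦂ b ⦂ T′ → T ≡ T′
∋-type-unique here      here      = refl
∋-type-unique (there p) (there q) = cong wk (∋-type-unique p q)

pi-injectiveᶜᵒᵈ : ∀ {a U s s′ T a′ U′ r r′ T′} → pi a U s s′ T ≡ pi a′ U′ r r′ T′ → T ≡ T′
pi-injectiveᶜᵒᵈ refl = refl

mutual
  ⟷ne-type-unique : ∀ {Δ n n₁ n₂ A₁ A₂} → Δ ⊢ n ⟷ne n₁ ⦂ A₁ → Δ ⊢ n ⟷ne n₂ ⦂ A₂ → A₁ ≡ A₂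
  ⟷ne-type-unique (ne-ev p T↘A₁) (ne-ev q T↘A₂) with ⟺ne-type-unique p q
  ... | refl = ↘-deterministic T↘A₁ T↘A₂

  ⟺ne-type-unique : ∀ {Δ n n₁ n₂ T₁ T₂} → Δ ⊢ n ⟺ne n₁ ⦂ T₁ → Δ ⊢ n ⟺ne n₂ ⦂ T₂ → T₁ ≡ T₂
  ⟺ne-type-unique (ne-var p)   (ne-var q)   = ∋-type-unique p q
  ⟺ne-type-unique (ne-rel p _) (ne-rel q _) = cong _[ _ ] (pi-injectiveᶜᵒᵈ (⟷ne-type-unique p q))
  ⟺ne-type-unique (ne-irr p)   (ne-irr q)   = cong _[ _ ] (pi-injectiveᶜᵒᵈ (⟷ne-type-unique p q))

lemma3p1 : (∀ {Δ n n₁ n₂ A₁ A₂} → Δ ⊢ n ⟷ne n₁ ⦂ A₁ → Δ ⊢ n ⟷ne n₂ ⦂ A₂ → A₁ ≡ A₂)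
         × (∀ {Δ n n₁ n₂ T₁ T₂} → Δ ⊢ n ⟺ne n₁ ⦂ T₁ → Δ ⊢ n ⟺ne n₂ ⦂ T₂ → T₁ ≡ T₂)
lemma3p1 = ⟷ne-type-unique , ⟺ne-type-unique
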